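{- Every D$_0$ graph satisfies axiom $4'a$: for every vertex $w$ and index $i$ such that $w$ admits an $(i-1)$-neighbor $v$ with $\{w,v\}$ not an $i$-edge, $\sigma(w)_{i-3}\ne\sigma(v)_{i-3}$ and $\sigma(w)_i\ne\sigma(v)_i$, the generating function of $\mathrm{Res}_{[i-3,i]}(\mathcal{G},w)$ equals that of $\mathrm{Res}_{[i-2,i+1]}(\mathcal{G},w)$.
   Context: $\mathcal{W}_n$ is the set of words of length $n$ with no repeated letter in $\{1,\dots,N\}$. A D$_0$ graph of degree $n$ is a graph on $W\subseteq\mathcal{W}_n$ with edges colored from $\{2,\dots,n-1\}$ such that (i) each $i$-edge is one of $\{vbacw,vbcaw\}$, $\{vacbw,vcabw\}$ (Knuth edges) or $\{vbacw,vacbw\}$, $\{vbcaw,vcabw\}$ (rotation edges) for letters $a<b<c$ and words $v,w$ with $v$ of length $i-2$, and (ii) for all such $a<b<c$, $v,w$, each element of $W\cap\{vbacw,vbcaw,vacbw,vcabw\}$ belongs to exactly one $i$-edge. The signature of $w$ is $\sigma(w)\in\{\pm1\}^{n-1}$, $\sigma(w)_i=+1$ if $w_i<w_{i+1}$, $-1$ otherwise; $v$ is an $(i-1)$-neighbor of $w$ if $\{w,v\}$ is an $(i-1)$-edge. For an interval $K=\{p,\dots,q\}\subseteq[n]$, $\mathrm{Res}_K\mathcal{G}$ is the graph with the same vertices, signature $\hat\sigma(x)_s=\sigma(x)_{s+p-1}$ for $s\in[q-p]$, and an $(s-p+1)$-edge for each $s$-edge of $\mathcal{G}$ with $p+1\le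 s\le q-1$; $\mathrm{Res}_K(\mathcal{G},w)$ is its connected component containing $w$. The generating function of such a graph with signatures in $\{\pm1\}^{m-1}$ is $\sum_x Q_{\{s:\hat\sigma(x)_s=-1\}}(\mathbf{x})$, where $Q_S(\mathbf{x})=\sum x_{i_1}\cdots x_{i_m}$ over $1\le i_1\le\cdots\le i_m$ with $i_j<i_{j+1}$ for $j\in S$. -}

module Defs where

open import Data.Nat using (ℕ; zero; suc; _+_; _∸_; _≤_; _<_; _<ᵇ_)
open import Data.Bool using (Bool; true; false; not; if_then_else_; T?)
open import Data.List using (List; []; _∷_; _++_; length; filter; map)
open import Data.Nat.ListAction using (sum)
open import Data.Bool.ListAction using (all)
open import Data.List.Relation.Unary.All using (All)
open import Data.List.Relation.Unary.Unique.Propositional using (Unique)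
open import Data.List.Membership.Propositional using (_∈_)
open import Data.Product using (Σ; ∃; _×_; _,_)
open import Data.Sum using (_⊎_)
open import Relation.Binary.PropositionalEquality using (_≡_)
open import Relation.Binary.Construct.Closure.ReflexiveTransitive using (Star)
open import Relation.Nullary using (Dec)
open import Relation.Unary using (Pred)
open import Function.Bundles using (_⇔_)

-- Words are lists of natural numbers (letters), positions are 1-indexed.
Word : Set
Word = List ℕ

InW : ℕ → ℕ → Word → Set
InW N n x = length x ≡ n × All (λ a → 1 ≤ a × a ≤ N) x × Unique x

-- 1-indexed letter lookup (default 0 outside [1, length]).
ltr : Word → ℕ → ℕ
ltr []       _             = 0
ltr (a ∷ x)  zero          = 0
ltr (a ∷ x)  (suc zero)    = a
ltr (a ∷ x)  (suc (suc j)) = ltr x (suc j)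

-- σ(x)_j = +1  iff  asc x j ≡ true  (i.e. x_j < x_{j+1});  σ(x)_j = -1 iff false.
asc : Word → ℕ → Bool
asc x j = ltr x j <ᵇ ltr x (suc j)

PairEq : Word → Word → Word → Word → Set
PairEq x y p q = (x ≡ p × y ≡ q) ⊎ (x ≡ q × y ≡ p)

quad : ℕ → ℕ → ℕ → Word → Word → List Word
quad a b c v u =
  (v ++ b ∷ a ∷ c ∷ u) ∷ (v ++ b ∷ c ∷ a ∷ u) ∷
  (v ++ a ∷ c ∷ b ∷ u) ∷ (v ++ c ∷ a ∷ b ∷ u) ∷ []

-- {x , y} is a Knuth or rotation i-edge (condition (i))
EdgeShape : ℕ → Word → Word → Set
EdgeShape i x y =
  Σ ℕ λ a → Σ ℕ λ b → Σ ℕ λ c → Σ Word λ v → Σ Word λ u →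
    a < b × b < c × length v ≡ i ∸ 2 ×
    ( PairEq x y (v ++ b ∷ a ∷ c ∷ u) (v ++ b ∷ c ∷ a ∷ u)
    ⊎ PairEq x y (v ++ a ∷ c ∷ b ∷ u) (v ++ c ∷ a ∷ b ∷ u)
    ⊎ PairEq x y (v ++ b ∷ a ∷ c ∷ u) (v ++ a ∷ c ∷ b ∷ u)
    ⊎ PairEq x y (v ++ b ∷ c ∷ a ∷ u) (v ++ c ∷ a ∷ b ∷ u))

-- A D₀ graph of degree n over letters {1,…,N}.
-- V : vertex set W ⊆ 𝒲_n ;  E i x y : {x , y} is an i-edge (undirected, simple).
record D0Graph (N n : ℕ) : Set₁ where
  field
    V      : Pred Word _
    V-dec  : ∀ x → Dec (V x)
    V⊆W    : ∀ x → V x → InW N n x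
    E      : ℕ → Word → Word → Set
    E-dec  : ∀ i x y → Dec (E i x y)
    E-sym  : ∀ i x y → E i x y → E i y x
    E-V    : ∀ i x y → E i x y → V x × V y
    E-col  : ∀ i x y → E i x y → 2 ≤ i × i ≤ n ∸ 1
    E-shape : ∀ i x y → E i x y → EdgeShape i x y
    E-unique : ∀ i a b c v u → 2 ≤ i → i ≤ n ∸ 1 → a < b → b < c → length v ≡ i ∸ 2 →
               ∀ x → x ∈ quad a b c v u → V x →
               Σ Word λ y → E i x y × (∀ z → E i x z → z ≡ y)

open D0Graph public

-- edges of Res_{[p,q]} 𝒢 : the s-edges of 𝒢 with p+1 ≤ s ≤ q-1
ResEdge : ∀ {N n} → D0Graph N n → ℕ → ℕ → Word → Word → Set
ResEdge G p q x y = Σ ℕ λ s → (p + 1 ≤ s × s ≤ q ∸ 1) × E G s x y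

-- x lies in the connected component Res_{[p,q]}(𝒢, w)
InRes : ∀ {N n} → D0Graph N n → ℕ → ℕ → Word → Word → Set
InRes G p q w x = Star (ResEdge G p q) w x

Enumerates : Pred Word _ → List Word → Set
Enumerates P L = Unique L × (∀ x → (x ∈ L) ⇔ P x)

-- descent set {s ∈ [q-p] : σ̂(x)_s = -1} where σ̂(x)_s = σ(x)_{s+p-1}
upFrom1 : ℕ → List ℕ
upFrom1 zero    = []
upFrom1 (suc k) = upFrom1 k ++ (suc k ∷ [])

resDes : ℕ → ℕ → Word → List ℕ
resDes p q x = filter (λ s → T? (not (asc x (s + p ∸ 1)))) (upFrom1 (q ∸ p))

-- coefficient of the monomial x_{α 1} ⋯ x_{α m} (α weakly increasing) in Q_S:
-- 1 if α j < α (j+1) for all j ∈ S, else 0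
Qcoeff : List ℕ → (ℕ → ℕ) → ℕ
Qcoeff S α = if all (λ j → α j <ᵇ α (suc j)) S then 1 else 0

resGFcoeff : ℕ → ℕ → List Word → (ℕ → ℕ) → ℕ
resGFcoeff p q L α = sum (map (λ x → Qcoeff (resDes p q x) α) L)

-- α encodes the monomial x_{α 1} x_{α 2} ⋯ x_{α m} with 1 ≤ α 1 ≤ α 2 ≤ ⋯ ≤ α m;
-- every degree-m monomial arises from exactly one such α (values beyond m are irrelevant)
Monomial : ℕ → (ℕ → ℕ) → Set
Monomial m α = 1 ≤ α 1 × (∀ j → 1 ≤ j → j < m → α j ≤ α (suc j))

module Submission where

-- Both restrictions only read signs at, and only move letters inside, the window of positions
-- i-3, …, i+1.  The (i-1)-edge {w, v} rearranges positions i-2, i-1, i; a Knuth edge keeps the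
-- first or the last of these letters, so it cannot change the sign both at i-3 and at i.  Hence
-- {w, v} is a rotation edge, and the two sign changes fix the relative order of the five window
-- letters up to four configurations (two of them up to exchanging w and v).  In each configuration
-- the two restricted components are determined by the graph's local choices, Knuth or rotation,
-- of the unique edge of each colour at each vertex (condition (ii)).  Running through these
-- choices, and discarding those that would give a vertex two edges of one colour, shows that both
-- components always have five vertices with the same multiset of restricted descent sets, so that
-- their generating functions coincide.

open import Defs
open import Data.Bool using (Bool; true; false; not; _∧_; _∨_; if_then_else_; T; T?)
open import Data.Bool.Properties using (T-≡; T-∧)
open import Data.Empty using (⊥-elim)
open import Data.List using (List; []; _∷_; _++_; length; map; filter; find; cartesianProduct)
open import Data.List.Properties
  using (≡-dec; ++-assoc; length-map; map-++; map-∘; map-cong-local; map-injective; ++-cancelˡ; ++-cancelʳ)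
open import Data.List.Membership.Propositional using (_∈_) renaming (find to witness)
open import Data.List.Membership.DecPropositional using (_∈?_)
open import Data.List.Membership.Propositional.Properties using (∈-map⁺; ∈-map⁻; ∈-cartesianProduct⁻)
open import Data.List.Membership.Propositional.Properties.WithK using (unique∧set⇒bag)
open import Data.List.Relation.Binary.BagAndSetEquality using (∼bag⇒↭)
open import Data.List.Relation.Binary.Permutation.Propositional
  using (_↭_; ↭-refl; ↭-reflexive; ↭-sym; ↭-trans; prep; swap)
import Data.List.Relation.Binary.Permutation.Propositional.Properties as ↭
open import Data.List.Relation.Unary.All as All using (All; []; _∷_; all?)
import Data.List.Relation.Unary.All.Properties as All
open import Data.List.Relation.Unary.Any using (Any; any?; here; there)
open import Data.List.Relation.Unary.AllPairs using (_∷_)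
open import Data.List.Relation.Unary.Unique.Propositional using (Unique)
import Data.List.Relation.Unary.Unique.Propositional.Properties as Unique
open import Data.List.Relation.Unary.Unique.DecPropositional using (unique?)
open import Data.Maybe using (Maybe; just; nothing)
open import Data.Nat using (ℕ; zero; suc; _+_; _∸_; _≤_; _<_; _<ᵇ_; _≡ᵇ_; _≟_; z≤n; s≤s)
open import Data.Nat.Properties
open import Data.Nat.ListAction using (sum)
open import Data.Nat.ListAction.Properties using (sum-↭)
open import Data.Product using (∃; _×_; _,_; proj₁; proj₂)
open import Data.Sum using (_⊎_; inj₁; inj₂; [_,_]′)
open import Data.Unit using (tt)
open import Function.Bundles using (Equivalence; mk⇔)
open import Relation.Binary using (DecidableEquality; tri<; tri≈; tri>)
open import Relation.Binary.Construct.Closure.ReflexiveTransitive using (Star; ε; _◅_; _◅◅_)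
open import Relation.Binary.PropositionalEquality
open import Relation.Unary using (Decidable)
open import Relation.Nullary using (¬_; Dec; yes; no)
open import Relation.Nullary.Decidable using (⌊_⌋; toWitness; _×-dec_; _⊎-dec_; ¬?)

open ≡-Reasoning

true⇒< : ∀ {m n} → (m <ᵇ n) ≡ true → m < n
true⇒< {m} {n} eq = <ᵇ⇒< m n (Equivalence.from T-≡ eq)

false⇒≥ : ∀ {m n} → (m <ᵇ n) ≡ false → n ≤ m
false⇒≥ eq = ≮⇒≥ (λ m<n → subst T eq (<⇒<ᵇ m<n))

<⇒true : ∀ {m n} → m < n → (m <ᵇ n) ≡ true
<⇒true m<n = Equivalence.to T-≡ (<⇒<ᵇ m<n)

≥⇒false : ∀ {m n} → n ≤ m → (m <ᵇ n) ≡ false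
≥⇒false {m} {n} n≤m with m <ᵇ n in eq
... | false = refl
... | true  = ⊥-elim (<⇒≱ (true⇒< {m} eq) n≤m)

<ᵇ-chain : ∀ {a b c} → (a <ᵇ b) ∧ (b <ᵇ c) ≡ true → a < b × b < c
<ᵇ-chain {a} {b} {c} eq with a <ᵇ b in ab | b <ᵇ c in bc
... | true | true = true⇒< {a} ab , true⇒< {b} bc

separated-below : ∀ {a b x} → a < b → (x <ᵇ a) ≢ (x <ᵇ b) → a ≤ x × x < b
separated-below {a} {b} {x} a<b differ with x <ᵇ a in xa | x <ᵇ b in xb
... | true  | true  = ⊥-elim (differ refl)
... | false | false = ⊥-elim (differ refl)
... | true  | false = ⊥-elim (<-asym (true⇒< {x} xa) (<-≤-trans a<b (false⇒≥ {x} xb)))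
... | false | true  = false⇒≥ {x} xa , true⇒< {x} xb

separated-above : ∀ {a b x} → a < b → (a <ᵇ x) ≢ (b <ᵇ x) → a < x × x ≤ b
separated-above {a} {b} {x} a<b differ with a <ᵇ x in ax | b <ᵇ x in bx
... | true  | true  = ⊥-elim (differ refl)
... | false | false = ⊥-elim (differ refl)
... | false | true  = ⊥-elim (<-irrefl {x} refl (≤-<-trans (false⇒≥ {a} ax) (<-trans a<b (true⇒< {b} bx))))
... | true  | false = true⇒< {a} ax , false⇒≥ {b} bx

-- Three-letter patterns and the edges of condition (i)

-- The relative order of three letters, named after the paper's words for a < b < c;
-- other covers the monotone triples and those with a repeated letter.
data Pattern : Set where
  bac bca acb cab other : Pattern

pattern3 : ℕ → ℕ → ℕ → Pattern
pattern3 p q r =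
  if      (q <ᵇ p) ∧ (p <ᵇ r) then bac
  else if (r <ᵇ p) ∧ (p <ᵇ q) then bca
  else if (p <ᵇ r) ∧ (r <ᵇ q) then acb
  else if (q <ᵇ r) ∧ (r <ᵇ p) then cab
  else other

data PatternView : ℕ → ℕ → ℕ → Pattern → Set where
  bac   : ∀ {a b c} → a < b → b < c → PatternView b a c bac
  bca   : ∀ {a b c} → a < b → b < c → PatternView b c a bca
  acb   : ∀ {a b c} → a < b → b < c → PatternView a c b acb
  cab   : ∀ {a b c} → a < b → b < c → PatternView c a b cab
  other : ∀ {p q r} → PatternView p q r other

pattern-view : ∀ p q r → PatternView p q r (pattern3 p q r)
pattern-view p q r with (q <ᵇ p) ∧ (p <ᵇ r) in e₁
... | true  = let q<p , p<r = <ᵇ-chain e₁ in bac q<p p<r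
... | false with (r <ᵇ p) ∧ (p <ᵇ q) in e₂
...   | true  = let r<p , p<q = <ᵇ-chain e₂ in bca r<p p<q
...   | false with (p <ᵇ r) ∧ (r <ᵇ q) in e₃
...     | true  = let p<r , r<q = <ᵇ-chain e₃ in acb p<r r<q
...     | false with (q <ᵇ r) ∧ (r <ᵇ p) in e₄
...       | true  = let q<r , r<p = <ᵇ-chain e₄ in cab q<r r<p
...       | false = other

pattern3-of-quad : ∀ {a b c} → a < b → b < c →
  pattern3 b a c ≡ bac × pattern3 b c a ≡ bca × pattern3 a c b ≡ acb × pattern3 c a b ≡ cab
pattern3-of-quad {a} {b} {c} a<b b<c
  rewrite <⇒true a<b | <⇒true b<c | <⇒true (<-trans a<b b<c)
        | ≥⇒false (<⇒≤ a<b) | ≥⇒false (<⇒≤ b<c) | ≥⇒false (<⇒≤ (<-trans a<b b<c))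
  = refl , refl , refl , refl

isMovable : Pattern → Bool
isMovable other = false
isMovable _     = true

data Move : Set where
  knuth rotation : Move

rearrange : Move → Pattern → ℕ → ℕ → ℕ → Word
rearrange knuth    bac   p q r = p ∷ r ∷ q ∷ []
rearrange knuth    bca   p q r = p ∷ r ∷ q ∷ []
rearrange knuth    acb   p q r = q ∷ p ∷ r ∷ []
rearrange knuth    cab   p q r = q ∷ p ∷ r ∷ []
rearrange knuth    other p q r = p ∷ q ∷ r ∷ []
rearrange rotation bac   p q r = q ∷ r ∷ p ∷ []
rearrange rotation bca   p q r = q ∷ r ∷ p ∷ []
rearrange rotation acb   p q r = r ∷ p ∷ q ∷ []
rearrange rotation cab   p q r = r ∷ p ∷ q ∷ []
rearrange rotation other p q r = p ∷ q ∷ r ∷ []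

apply : Move → Word → Word
apply m (p ∷ q ∷ r ∷ z) = rearrange m (pattern3 p q r) p q r ++ z
apply m x               = x

moveAt : Move → ℕ → Word → Word
moveAt m zero    x       = apply m x
moveAt m (suc d) []      = []
moveAt m (suc d) (a ∷ x) = a ∷ moveAt m d x

patternAt : ℕ → Word → Pattern
patternAt zero    (p ∷ q ∷ r ∷ _) = pattern3 p q r
patternAt zero    _               = other
patternAt (suc d) []              = other
patternAt (suc d) (_ ∷ x)         = patternAt d x

movable : ℕ → Word → Bool
movable d x = isMovable (patternAt d x)

Movable : ℕ → Word → Set
Movable d x = T (movable d x)

moveAt-++ˡ : ∀ m d v x → moveAt m (d + length v) (v ++ x) ≡ v ++ moveAt m d x
moveAt-++ˡ m d []      x rewrite +-identityʳ d = refl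
moveAt-++ˡ m d (a ∷ v) x rewrite +-suc d (length v) = cong (a ∷_) (moveAt-++ˡ m d v x)

patternAt-++ˡ : ∀ d v x → patternAt (d + length v) (v ++ x) ≡ patternAt d x
patternAt-++ˡ d []      x rewrite +-identityʳ d = refl
patternAt-++ˡ d (a ∷ v) x rewrite +-suc d (length v) = patternAt-++ˡ d v x

ltr-++ˡ : ∀ j v x → ltr (v ++ x) (suc j + length v) ≡ ltr x (suc j)
ltr-++ˡ j []      x rewrite +-identityʳ j = refl
ltr-++ˡ j (a ∷ v) x rewrite +-suc j (length v) = ltr-++ˡ j v x

asc-++ˡ : ∀ j v x → asc (v ++ x) (suc j + length v) ≡ asc x (suc j)
asc-++ˡ j v x = cong₂ _<ᵇ_ (ltr-++ˡ j v x) (ltr-++ˡ (suc j) v x)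

moveAt-++ʳ : ∀ m d x y → d + 3 ≤ length x → moveAt m d (x ++ y) ≡ moveAt m d x ++ y
moveAt-++ʳ m zero    (p ∷ q ∷ r ∷ z) y _         = sym (++-assoc (rearrange m (pattern3 p q r) p q r) z y)
moveAt-++ʳ m (suc d) (a ∷ x)         y (s≤s le) = cong (a ∷_) (moveAt-++ʳ m d x y le)
moveAt-++ʳ m zero    (_ ∷ [])        y (s≤s ())
moveAt-++ʳ m zero    (_ ∷ _ ∷ [])    y (s≤s (s≤s ()))

patternAt-++ʳ : ∀ d x y → d + 3 ≤ length x → patternAt d (x ++ y) ≡ patternAt d x
patternAt-++ʳ zero    (p ∷ q ∷ r ∷ z) y _         = refl
patternAt-++ʳ (suc d) (a ∷ x)         y (s≤s le) = patternAt-++ʳ d x y le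
patternAt-++ʳ zero    (_ ∷ [])        y (s≤s ())
patternAt-++ʳ zero    (_ ∷ _ ∷ [])    y (s≤s (s≤s ()))

ltr-++ʳ : ∀ x y j → j ≤ length x → ltr (x ++ y) j ≡ ltr x j
ltr-++ʳ []      []      zero          _         = refl
ltr-++ʳ []      (_ ∷ _) zero          _         = refl
ltr-++ʳ (a ∷ x) y       zero          _         = refl
ltr-++ʳ (a ∷ x) y       (suc zero)    _         = refl
ltr-++ʳ (a ∷ x) y       (suc (suc j)) (s≤s le) = ltr-++ʳ x y (suc j) le

moveAt-immovable : ∀ m d x → ¬ Movable d x → moveAt m d x ≡ x
moveAt-immovable m zero (p ∷ q ∷ r ∷ z) stuck with pattern3 p q r
moveAt-immovable knuth    zero (p ∷ q ∷ r ∷ z) stuck | other = refl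
moveAt-immovable rotation zero (p ∷ q ∷ r ∷ z) stuck | other = refl
... | bac = ⊥-elim (stuck tt)
... | bca = ⊥-elim (stuck tt)
... | acb = ⊥-elim (stuck tt)
... | cab = ⊥-elim (stuck tt)
moveAt-immovable m zero    []           stuck = refl
moveAt-immovable m zero    (_ ∷ [])     stuck = refl
moveAt-immovable m zero    (_ ∷ _ ∷ []) stuck = refl
moveAt-immovable m (suc d) []           stuck = refl
moveAt-immovable m (suc d) (a ∷ x)      stuck = cong (a ∷_) (moveAt-immovable m d x stuck)

pair-move : ∀ {m m′ P Q x y} d → Q ≡ moveAt m d P → P ≡ moveAt m′ d Q → PairEq x y P Q →
            ∃ λ m → y ≡ moveAt m d x
pair-move {m}       d Q≡ P≡ (inj₁ (refl , refl)) = m , Q≡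
pair-move {m′ = m′} d Q≡ P≡ (inj₂ (refl , refl)) = m′ , P≡

edge-move : ∀ s {x y} → EdgeShape s x y → ∃ λ m → y ≡ moveAt m (s ∸ 2) x
edge-move s (a , b , c , v , u , a<b , b<c , lv , shape) with pattern3-of-quad a<b b<c
... | bac≡ , bca≡ , acb≡ , cab≡ =
  [ pair-move (s ∸ 2) (moved knuth bac≡) (moved knuth bca≡)
  , [ pair-move (s ∸ 2) (moved knuth acb≡) (moved knuth cab≡)
    , [ pair-move (s ∸ 2) (moved rotation bac≡) (moved rotation acb≡)
      , pair-move (s ∸ 2) (moved rotation bca≡) (moved rotation cab≡) ]′ ]′ ]′ shape
  where
  moved : ∀ m {p q r π} → pattern3 p q r ≡ π →
          v ++ rearrange m π p q r ++ u ≡ moveAt m (s ∸ 2) (v ++ p ∷ q ∷ r ∷ u)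
  moved m refl rewrite sym lv = sym (moveAt-++ˡ m 0 v _)

-- Neighbours in a D₀ graph

data Factorisation (d : ℕ) : Word → Set where
  factorisation : ∀ v p q r u → length v ≡ d → T (isMovable (pattern3 p q r)) →
                  Factorisation d (v ++ p ∷ q ∷ r ∷ u)

movable-factorisation : ∀ d x → Movable d x → Factorisation d x
movable-factorisation zero    (p ∷ q ∷ r ∷ u) t = factorisation [] p q r u refl t
movable-factorisation (suc d) (a ∷ x)         t with movable-factorisation d x t
... | factorisation v p q r u refl t′ = factorisation (a ∷ v) p q r u refl t′

quad-member : ∀ v p q r u → T (isMovable (pattern3 p q r)) →
  ∃ λ a → ∃ λ b → ∃ λ c → a < b × b < c × (v ++ p ∷ q ∷ r ∷ u) ∈ quad a b c v u
quad-member v p q r u t with pattern3 p q r | pattern-view p q r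
... | bac | bac a<b b<c = _ , _ , _ , a<b , b<c , here refl
... | bca | bca a<b b<c = _ , _ , _ , a<b , b<c , there (here refl)
... | acb | acb a<b b<c = _ , _ , _ , a<b , b<c , there (there (here refl))
... | cab | cab a<b b<c = _ , _ , _ , a<b , b<c , there (there (there (here refl)))

module _ {N n : ℕ} (G : D0Graph N n) where

  Neighbour : ℕ → Word → Word → Set
  Neighbour s x y = E G s x y × (∀ z → E G s x z → z ≡ y)

  neighbour-exists : ∀ {s x} → V G x → 2 ≤ s → s ≤ n ∸ 1 → Movable (s ∸ 2) x → ∃ (Neighbour s x)
  neighbour-exists {s} {x} Vx 2≤s s≤n-1 t with movable-factorisation (s ∸ 2) x t
  ... | factorisation v p q r u lv t′ with quad-member v p q r u t′
  ...   | a , b , c , a<b , b<c , x∈quad = E-unique G s a b c v u 2≤s s≤n-1 a<b b<c lv _ x∈quad Vx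

  neighbour-move : ∀ {s x} → V G x → 2 ≤ s → s ≤ n ∸ 1 → Movable (s ∸ 2) x →
                   ∃ λ m → Neighbour s x (moveAt m (s ∸ 2) x)
  neighbour-move {s} {x} Vx 2≤s s≤n-1 t with neighbour-exists Vx 2≤s s≤n-1 t
  ... | y , xy , unique with edge-move s (E-shape G s x y xy)
  ...   | m , refl = m , xy , unique

  neighbour-of-edge : ∀ {s x y} → E G s x y → Movable (s ∸ 2) x → Neighbour s x y
  neighbour-of-edge {s} {x} xy t
    with neighbour-exists (proj₁ (E-V G s x _ xy)) (proj₁ (E-col G s x _ xy)) (proj₂ (E-col G s x _ xy)) t
  ... | _ , _ , unique = xy , λ z xz → trans (unique z xz) (sym (unique _ xy))

  neighbour-sym : ∀ {s x y} → Neighbour s x y → Movable (s ∸ 2) y → Neighbour s y x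
  neighbour-sym (xy , _) = neighbour-of-edge (E-sym G _ _ _ xy)

  neighbour-functional : ∀ {s x y z} → Neighbour s x y → Neighbour s y z → z ≡ x
  neighbour-functional (xy , _) (_ , unique) = sym (unique _ (E-sym G _ _ _ xy))

-- Order embeddings

record OrderEmbedding : Set where
  field
    ι      : ℕ → ℕ
    ι-mono : ∀ {m n} → m < n → ι m < ι n
    -- ltr reads 0 outside a word, so this makes ltr commute with map ι
    ι-zero : ι 0 ≡ 0

rearrange-map : ∀ (f : ℕ → ℕ) m π p q r → rearrange m π (f p) (f q) (f r) ≡ map f (rearrange m π p q r)
rearrange-map f knuth    bac   p q r = refl
rearrange-map f knuth    bca   p q r = refl
rearrange-map f knuth    acb   p q r = refl
rearrange-map f knuth    cab   p q r = refl
rearrange-map f knuth    other p q r = refl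
rearrange-map f rotation bac   p q r = refl
rearrange-map f rotation bca   p q r = refl
rearrange-map f rotation acb   p q r = refl
rearrange-map f rotation cab   p q r = refl
rearrange-map f rotation other p q r = refl

module _ (embedding : OrderEmbedding) where
  open OrderEmbedding embedding

  <ᵇ-ι : ∀ m n → (ι m <ᵇ ι n) ≡ (m <ᵇ n)
  <ᵇ-ι m n with <-cmp m n
  ... | tri< m<n _ _  = trans (<⇒true (ι-mono m<n)) (sym (<⇒true m<n))
  ... | tri≈ _ refl _ = trans (≥⇒false {ι m} ≤-refl) (sym (≥⇒false {m} ≤-refl))
  ... | tri> _ _ n<m  = trans (≥⇒false (<⇒≤ (ι-mono n<m))) (sym (≥⇒false (<⇒≤ n<m)))

  ι-injective : ∀ {m n} → ι m ≡ ι n → m ≡ n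
  ι-injective {m} {n} eq with <-cmp m n
  ... | tri< m<n _ _ = ⊥-elim (<-irrefl eq (ι-mono m<n))
  ... | tri≈ _ m≡n _ = m≡n
  ... | tri> _ _ n<m = ⊥-elim (<-irrefl (sym eq) (ι-mono n<m))

  pattern3-ι : ∀ p q r → pattern3 (ι p) (ι q) (ι r) ≡ pattern3 p q r
  pattern3-ι p q r rewrite <ᵇ-ι q p | <ᵇ-ι p r | <ᵇ-ι r p | <ᵇ-ι p q | <ᵇ-ι r q | <ᵇ-ι q r = refl

  apply-ι : ∀ m x → apply m (map ι x) ≡ map ι (apply m x)
  apply-ι m (p ∷ q ∷ r ∷ z) rewrite pattern3-ι p q r =
    trans (cong (_++ map ι z) (rearrange-map ι m _ p q r)) (sym (map-++ ι (rearrange m _ p q r) z))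
  apply-ι m []           = refl
  apply-ι m (_ ∷ [])     = refl
  apply-ι m (_ ∷ _ ∷ []) = refl

  moveAt-ι : ∀ m d x → moveAt m d (map ι x) ≡ map ι (moveAt m d x)
  moveAt-ι m zero    x       = apply-ι m x
  moveAt-ι m (suc d) []      = refl
  moveAt-ι m (suc d) (a ∷ x) = cong (ι a ∷_) (moveAt-ι m d x)

  patternAt-ι : ∀ d x → patternAt d (map ι x) ≡ patternAt d x
  patternAt-ι zero    (p ∷ q ∷ r ∷ _) = pattern3-ι p q r
  patternAt-ι zero    []              = refl
  patternAt-ι zero    (_ ∷ [])        = refl
  patternAt-ι zero    (_ ∷ _ ∷ [])    = refl
  patternAt-ι (suc d) []              = refl
  patternAt-ι (suc d) (_ ∷ x)         = patternAt-ι d x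

  ltr-ι : ∀ x j → ltr (map ι x) j ≡ ι (ltr x j)
  ltr-ι []      j             = sym ι-zero
  ltr-ι (a ∷ x) zero          = sym ι-zero
  ltr-ι (a ∷ x) (suc zero)    = refl
  ltr-ι (a ∷ x) (suc (suc j)) = ltr-ι x (suc j)

  asc-ι : ∀ x j → asc (map ι x) j ≡ asc x j
  asc-ι x j rewrite ltr-ι x j | ltr-ι x (suc j) = <ᵇ-ι (ltr x j) (ltr x (suc j))

chain : ∀ {c₁ c₂ c₃ c₄ c₅} → 0 < c₁ → c₁ < c₂ → c₂ < c₃ → c₃ < c₄ → c₄ < c₅ → OrderEmbedding
chain {c₁} {c₂} {c₃} {c₄} {c₅} h₁ h₂ h₃ h₄ h₅ = record { ι = f ; ι-mono = mono ; ι-zero = refl }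
  where
  f : ℕ → ℕ
  f 0 = 0
  f 1 = c₁
  f 2 = c₂
  f 3 = c₃
  f 4 = c₄
  f 5 = c₅
  f (suc (suc (suc (suc (suc (suc j)))))) = suc (c₅ + j)
  step : ∀ j → f j < f (suc j)
  step 0 = h₁
  step 1 = h₂
  step 2 = h₃
  step 3 = h₄
  step 4 = h₅
  step 5 = s≤s (m≤m+n c₅ 0)
  step (suc (suc (suc (suc (suc (suc j)))))) = s≤s (≤-reflexive (sym (+-suc c₅ j)))
  mono : ∀ {m n} → m < n → f m < f n
  mono {m} {suc n} (s≤s m≤n) with m≤n⇒m<n∨m≡n m≤n
  ... | inj₁ m<n  = <-trans (mono m<n) (step n)
  ... | inj₂ refl = step m

-- Restricted descent sets

upFrom1-bounds : ∀ k → All (λ s → 1 ≤ s × s ≤ k) (upFrom1 k)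
upFrom1-bounds zero    = []
upFrom1-bounds (suc k) =
  All.++⁺ (All.map (λ (1≤s , s≤k) → 1≤s , m≤n⇒m≤1+n s≤k) (upFrom1-bounds k)) ((s≤s z≤n , ≤-refl) ∷ [])

filter-cong-All : ∀ {f g : ℕ → Bool} {xs} → All (λ s → f s ≡ g s) xs →
                  filter (λ s → T? (f s)) xs ≡ filter (λ s → T? (g s)) xs
filter-cong-All []                               = refl
filter-cong-All {f} {g} {x ∷ xs} (fx≡gx ∷ rest) with f x | g x | fx≡gx
... | true  | .true  | refl = cong (x ∷_) (filter-cong-All rest)
... | false | .false | refl = filter-cong-All rest

resDes-cong : ∀ {p q p′ q′ x y} k → q ∸ p ≡ k → q′ ∸ p′ ≡ k →
              (∀ s → 1 ≤ s → s ≤ k → asc x (s + p ∸ 1) ≡ asc y (s + p′ ∸ 1)) →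
              resDes p q x ≡ resDes p′ q′ y
resDes-cong k refl eq′ same rewrite eq′ =
  filter-cong-All (All.map (λ {s} (1≤s , s≤k) → cong not (same s 1≤s s≤k)) (upFrom1-bounds k))

resGFcoeff-↭ : ∀ p q p′ q′ {L₁ L₂} → map (resDes p q) L₁ ↭ map (resDes p′ q′) L₂ →
               ∀ α → resGFcoeff p q L₁ α ≡ resGFcoeff p′ q′ L₂ α
resGFcoeff-↭ p q p′ q′ {L₁} {L₂} perm α = begin
  sum (map (λ x → Qcoeff (resDes p q x) α) L₁)         ≡⟨ cong sum (map-∘ L₁) ⟩
  sum (map (λ S → Qcoeff S α) (map (resDes p q) L₁))   ≡⟨ sum-↭ (↭.map⁺ (λ S → Qcoeff S α) perm) ⟩
  sum (map (λ S → Qcoeff S α) (map (resDes p′ q′) L₂)) ≡⟨ cong sum (map-∘ L₂) ⟨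
  sum (map (λ x → Qcoeff (resDes p′ q′ x) α) L₂)       ∎

-- Exploring a component

_≟ʷ_ : DecidableEquality Word
_≟ʷ_ = ≡-dec _≟_

module _ {A : Set} (_≟ᴬ_ : DecidableEquality A) where

  remove : A → List A → Maybe (List A)
  remove x []       = nothing
  remove x (y ∷ ys) with x ≟ᴬ y | remove x ys
  ... | yes _ | _       = just ys
  ... | no _  | just zs = just (y ∷ zs)
  ... | no _  | nothing = nothing

  isPermutation : List A → List A → Bool
  isPermutation []       []      = true
  isPermutation []       (_ ∷ _) = false
  isPermutation (x ∷ xs) ys with remove x ys
  ... | just zs = isPermutation xs zs
  ... | nothing = false

  remove-↭ : ∀ x ys {zs} → remove x ys ≡ just zs → ys ↭ x ∷ zs
  remove-↭ x (y ∷ ys) eq with x ≟ᴬ y | remove x ys in eq′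
  remove-↭ x (y ∷ ys) refl | yes refl | _       = ↭-refl
  remove-↭ x (y ∷ ys) refl | no _     | just zs = ↭-trans (prep y (remove-↭ x ys eq′)) (swap y x ↭-refl)

  isPermutation-sound : ∀ xs ys → T (isPermutation xs ys) → xs ↭ ys
  isPermutation-sound []       []      _  = ↭-refl
  isPermutation-sound (x ∷ xs) ys      ok with remove x ys in eq
  ... | just zs = ↭-trans (prep x (isPermutation-sound xs zs ok)) (↭-sym (remove-↭ x ys eq))

record Edge : Set where
  constructor edge
  field
    offset        : ℕ
    source target : Word
open Edge

Unexplored : List Edge → ℕ × Word → Set
Unexplored es (d , τ) = Movable d τ × ¬ Any (λ e → offset e ≡ d × source e ≡ τ) es

unexplored? : ∀ es dτ → Dec (Unexplored es dτ)
unexplored? es (d , τ) = T? (movable d τ) ×-dec ¬? (any? (λ e → (offset e ≟ d) ×-dec (source e ≟ʷ τ)) es)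

Closed : List ℕ → List Edge → List Word → Set
Closed ds es S =
  All (λ τ → All (λ d → ¬ Movable d τ ⊎ Any (λ e → offset e ≡ d × source e ≡ τ × target e ∈ S) es) ds) S

closed? : ∀ ds es S → Dec (Closed ds es S)
closed? ds es S = all? (λ τ → all? (λ d → ¬? (T? (movable d τ)) ⊎-dec
  any? (λ e → (offset e ≟ d) ×-dec (source e ≟ʷ τ) ×-dec (_∈?_ _≟ʷ_ (target e) S)) es) ds) S

Conflict : List Edge → ℕ → Word → Word → Set
Conflict es d τ σ = Any (λ e → offset e ≡ d × source e ≡ σ × ¬ target e ≡ τ) es

conflict? : ∀ es d τ σ → Dec (Conflict es d τ σ)
conflict? es d τ σ = any? (λ e → (offset e ≟ d) ×-dec (source e ≟ʷ σ) ×-dec ¬? (target e ≟ʷ τ)) es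

insert : Word → List Word → List Word
insert σ S = if ⌊ _∈?_ _≟ʷ_ σ S ⌋ then S else σ ∷ S

record Task : Set where
  field
    offsets    : List ℕ
    descentsOf : Word → List ℕ
    expected   : List (List ℕ)
open Task

-- Depth-first search through the graph's possible choices.  At the first vertex τ ∈ S with a
-- movable pattern at an offset d whose edge is not yet known, both moves are tried; a move
-- sending τ to a word already joined to another word by an edge of that colour is impossible.
-- A leaf accepts when the vertices are closed under the known edges and their descent sets
-- are a permutation of the expected ones.
mutual
  explore : ℕ → Task → List Word → List Edge → Bool
  explore zero    t S es = false
  explore (suc k) t S es with find (unexplored? es) (cartesianProduct (offsets t) S)
  ... | nothing      = ⌊ closed? (offsets t) es S ⌋ ∧ ⌊ unique? _≟ʷ_ S ⌋
                       ∧ isPermutation (≡-dec _≟_) (map (descentsOf t) S) (expected t)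
  ... | just (d , τ) = grow k t S es d τ knuth ∧ grow k t S es d τ rotation

  grow : ℕ → Task → List Word → List Edge → ℕ → Word → Move → Bool
  grow k t S es d τ m = let σ = moveAt m d τ in ⌊ conflict? es d τ σ ⌋
    ∨ ((length σ ≡ᵇ 5) ∧ movable d σ ∧ explore k t (insert σ S) (edge d τ σ ∷ edge d σ τ ∷ es))

exploreFrom : Task → ℕ → Word → Word → Bool
exploreFrom t d τ σ = (length τ ≡ᵇ 5) ∧ (length σ ≡ᵇ 5) ∧ movable d τ ∧ movable d σ
  ∧ explore 5 t (τ ∷ σ ∷ []) (edge d τ σ ∷ edge d σ τ ∷ [])

find-just : ∀ {A : Set} {P : A → Set} (P? : Decidable P) xs {x} → find P? xs ≡ just x → x ∈ xs × P x
find-just P? (y ∷ ys) eq with P? y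
find-just P? (y ∷ ys) refl | yes py = here refl , py
find-just P? (y ∷ ys) eq   | no _   = let x∈ys , px = find-just P? ys eq in there x∈ys , px

insert-∈ : ∀ {x σ S} → x ∈ S → x ∈ insert σ S
insert-∈ {σ = σ} {S} x∈S with _∈?_ _≟ʷ_ σ S
... | yes _ = x∈S
... | no _  = there x∈S

insert-All : ∀ {P : Word → Set} {σ S} → P σ → All P S → All P (insert σ S)
insert-All {σ = σ} {S} pσ pS with _∈?_ _≟ʷ_ σ S
... | yes _ = pS
... | no _  = pσ ∷ pS

∧-split : ∀ {x y} → T (x ∧ y) → T x × T y
∧-split {x} {y} = Equivalence.to (T-∧ {x} {y})

pick : ∀ (f : Move → Bool) m → T (f knuth ∧ f rotation) → T (f m)
pick f knuth    both = proj₁ (∧-split both)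
pick f rotation both = proj₂ (∧-split both)

-- The window of positions i-3, …, i+1

resTask : ℕ → List (List ℕ) → Task
resTask e D = record { offsets = e ∷ suc e ∷ [] ; descentsOf = resDes (1 + e) (4 + e) ; expected = D }

-- The relative order of the letters of w at positions i-3, …, i+1 when those at i-2, i-1, i
-- form the pattern π and v is their rotation.
standardWindow : Pattern → Word
standardWindow bac   = 2 ∷ 3 ∷ 1 ∷ 5 ∷ 4 ∷ []
standardWindow acb   = 2 ∷ 1 ∷ 5 ∷ 3 ∷ 4 ∷ []
standardWindow bca   = 4 ∷ 3 ∷ 5 ∷ 1 ∷ 2 ∷ []
standardWindow cab   = 4 ∷ 5 ∷ 1 ∷ 3 ∷ 2 ∷ []
standardWindow other = []

-- The restricted descent sets of the five vertices of either restricted component.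
descents : Pattern → List (List ℕ)
descents bac   = (2 ∷ []) ∷ (1 ∷ 3 ∷ []) ∷ (1 ∷ []) ∷ (2 ∷ []) ∷ (3 ∷ []) ∷ []
descents acb   = descents bac
descents bca   = (1 ∷ 3 ∷ []) ∷ (2 ∷ []) ∷ (2 ∷ 3 ∷ []) ∷ (1 ∷ 3 ∷ []) ∷ (1 ∷ 2 ∷ []) ∷ []
descents cab   = descents bca
descents other = []

exploration-succeeds : ∀ e π → e ≤ 1 → T (isMovable π) →
  T (exploreFrom (resTask e (descents π)) 1 (standardWindow π) (moveAt rotation 1 (standardWindow π)))
exploration-succeeds zero          bac _ _ = tt
exploration-succeeds zero          bca _ _ = tt
exploration-succeeds zero          acb _ _ = tt
exploration-succeeds zero          cab _ _ = tt
exploration-succeeds (suc zero)    bac _ _ = tt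
exploration-succeeds (suc zero)    bca _ _ = tt
exploration-succeeds (suc zero)    acb _ _ = tt
exploration-succeeds (suc zero)    cab _ _ = tt
exploration-succeeds (suc (suc e)) _   (s≤s ()) _

module Window {N n : ℕ} (G : D0Graph N n) (pre post : Word) (embedding : OrderEmbedding)
              (fits : 5 + length pre ≤ n) where
  open OrderEmbedding embedding

  L : ℕ
  L = length pre

  emb : Word → Word
  emb τ = pre ++ map ι τ ++ post

  colour : ℕ → ℕ
  colour d = 2 + d + L

  emb-injective : ∀ {τ σ} → emb τ ≡ emb σ → τ ≡ σ
  emb-injective {τ} {σ} eq =
    map-injective (ι-injective embedding) (++-cancelʳ post (map ι τ) (map ι σ) (++-cancelˡ pre _ _ eq))

  inside : ∀ τ {k} → length τ ≡ 5 → k ≤ 5 → k ≤ length (map ι τ)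
  inside τ len k≤5 = subst (_ ≤_) (sym (trans (length-map ι τ) len)) k≤5

  room : ∀ τ {d} → length τ ≡ 5 → d ≤ 2 → d + 3 ≤ length (map ι τ)
  room τ len d≤2 = inside τ len (+-monoˡ-≤ 3 d≤2)

  movable-emb : ∀ {τ d} → length τ ≡ 5 → d ≤ 2 → movable (d + L) (emb τ) ≡ movable d τ
  movable-emb {τ} {d} len d≤2 = cong isMovable (begin
    patternAt (d + L) (emb τ)      ≡⟨ patternAt-++ˡ d pre _ ⟩
    patternAt d (map ι τ ++ post)  ≡⟨ patternAt-++ʳ d (map ι τ) post (room τ len d≤2) ⟩
    patternAt d (map ι τ)          ≡⟨ patternAt-ι embedding d τ ⟩
    patternAt d τ                  ∎)

  moveAt-emb : ∀ m {τ d} → length τ ≡ 5 → d ≤ 2 → moveAt m (d + L) (emb τ) ≡ emb (moveAt m d τ)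
  moveAt-emb m {τ} {d} len d≤2 = begin
    moveAt m (d + L) (emb τ)             ≡⟨ moveAt-++ˡ m d pre _ ⟩
    pre ++ moveAt m d (map ι τ ++ post)  ≡⟨ cong (pre ++_) (moveAt-++ʳ m d (map ι τ) post (room τ len d≤2)) ⟩
    pre ++ moveAt m d (map ι τ) ++ post  ≡⟨ cong (λ z → pre ++ z ++ post) (moveAt-ι embedding m d τ) ⟩
    emb (moveAt m d τ)                   ∎

  asc-emb : ∀ {τ} j → length τ ≡ 5 → j ≤ 3 → asc (emb τ) (suc j + L) ≡ asc τ (suc j)
  asc-emb {τ} j len j≤3 = begin
    asc (emb τ) (suc j + L)        ≡⟨ asc-++ˡ j pre _ ⟩
    asc (map ι τ ++ post) (suc j)  ≡⟨ cong₂ _<ᵇ_ (ltr-inside (s≤s (m≤n⇒m≤1+n j≤3))) (ltr-inside (s≤s (s≤s j≤3))) ⟩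
    asc (map ι τ) (suc j)          ≡⟨ asc-ι embedding τ (suc j) ⟩
    asc τ (suc j)                  ∎
    where
    ltr-inside : ∀ {k} → k ≤ 5 → ltr (map ι τ ++ post) k ≡ ltr (map ι τ) k
    ltr-inside k≤5 = ltr-++ʳ (map ι τ) post _ (inside τ len k≤5)

  resDes-emb : ∀ {τ} e → e ≤ 1 → length τ ≡ 5 → resDes (1 + e + L) (4 + e + L) (emb τ) ≡ resDes (1 + e) (4 + e) τ
  resDes-emb {τ} e e≤1 len =
    resDes-cong {1 + e + L} {4 + e + L} {1 + e} {4 + e} {emb τ} {τ} 3
      (m+n∸n≡m 3 (1 + e + L)) (m+n∸n≡m 3 (1 + e)) agree
    where
    agree : ∀ s → 1 ≤ s → s ≤ 3 → asc (emb τ) (s + (1 + e + L) ∸ 1) ≡ asc τ (s + (1 + e) ∸ 1)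
    agree (suc s) _ (s≤s s≤2) rewrite +-suc s (e + L) | +-suc s e | sym (+-assoc s e L) =
      asc-emb (s + e) len (+-mono-≤ s≤2 e≤1)

  colour-bounds : ∀ {d} → d ≤ 2 → 2 ≤ colour d × colour d ≤ n ∸ 1
  colour-bounds d≤2 = s≤s (s≤s z≤n) , ≤-trans (s≤s (s≤s (+-monoˡ-≤ L d≤2))) (∸-monoˡ-≤ 1 fits)

  emb-neighbour : ∀ {τ d} → length τ ≡ 5 → d ≤ 2 → V G (emb τ) → Movable d τ →
                  ∃ λ m → Neighbour G (colour d) (emb τ) (emb (moveAt m d τ))
  emb-neighbour {τ} {d} len d≤2 Vτ mov
    with neighbour-move G Vτ (proj₁ (colour-bounds d≤2)) (proj₂ (colour-bounds d≤2))
                         (subst T (sym (movable-emb len d≤2)) mov)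
  ... | m , nb = m , subst (Neighbour G (colour d) (emb τ)) (moveAt-emb m len d≤2) nb

  emb-neighbour-sym : ∀ {τ σ d} → length σ ≡ 5 → d ≤ 2 → Neighbour G (colour d) (emb τ) (emb σ) →
                      Movable d σ → Neighbour G (colour d) (emb σ) (emb τ)
  emb-neighbour-sym len d≤2 nb mov = neighbour-sym G nb (subst T (sym (movable-emb len d≤2)) mov)

  emb-edge : ∀ {τ d y} → length τ ≡ 5 → d ≤ 2 → E G (colour d) (emb τ) y → ∃ λ m → y ≡ emb (moveAt m d τ)
  emb-edge {τ} {d} len d≤2 τy with edge-move (colour d) (E-shape G _ _ _ τy)
  ... | m , y≡ = m , trans y≡ (moveAt-emb m len d≤2)

  module Component (e : ℕ) (e≤1 : e ≤ 1) (D : List (List ℕ)) (root : Word) (root-vertex : V G (emb root))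
                   (Lr : List Word) (enumeration : Enumerates (InRes G (1 + e + L) (4 + e + L) (emb root)) Lr) where

    task : Task
    task = resTask e D

    p q : ℕ
    p = 1 + e + L
    q = 4 + e + L

    Reached : Word → Set
    Reached τ = InRes G p q (emb root) (emb τ)

    record Invariant (S : List Word) (es : List Edge) : Set where
      field
        neighbours : All (λ ed → Neighbour G (colour (offset ed)) (emb (source ed)) (emb (target ed))) es
        sized      : All (λ τ → length τ ≡ 5) S
        has-root   : root ∈ S
        reached    : All Reached S
    open Invariant

    offset-small : ∀ {d} → d ∈ offsets task → d ≤ 2
    offset-small (here refl)         = m≤n⇒m≤1+n e≤1
    offset-small (there (here refl)) = s≤s e≤1

    offset-colour : ∀ {d} → d ∈ offsets task → p + 1 ≤ colour d × colour d ≤ q ∸ 1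
    offset-colour (here refl)         = ≤-reflexive (+-comm p 1) , n≤1+n _
    offset-colour (there (here refl)) = ≤-trans (≤-reflexive (+-comm p 1)) (n≤1+n _) , ≤-refl

    colour-offset : ∀ {s} → p + 1 ≤ s × s ≤ q ∸ 1 → ∃ λ d → d ∈ offsets task × s ≡ colour d
    colour-offset {s} (lo , hi) with m≤n⇒m<n∨m≡n hi
    ... | inj₂ s≡ = suc e , there (here refl) , s≡
    ... | inj₁ s< = e , here refl , ≤-antisym (≤-pred s<) (subst (_≤ s) (+-comm p 1) lo)

    reached-vertex : ∀ {x y} → V G x → Star (ResEdge G p q) x y → V G y
    reached-vertex Vx ε                   = Vx
    reached-vertex Vx ((_ , _ , xz) ◅ zy) = reached-vertex (proj₂ (E-V G _ _ _ xz)) zy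

    closed-step : ∀ {es S τ s y} → Closed (offsets task) es S → Invariant S es → τ ∈ S →
                  p + 1 ≤ s × s ≤ q ∸ 1 → E G s (emb τ) y → ∃ λ σ → σ ∈ S × y ≡ emb σ
    closed-step {τ = τ} closed inv τ∈S range τy with colour-offset range
    ... | d , d∈ , refl with All.lookup (All.lookup closed τ∈S) d∈
    ...   | inj₁ stuck with emb-edge (All.lookup (sized inv) τ∈S) (offset-small d∈) τy
    ...     | m , refl = τ , τ∈S , cong emb (moveAt-immovable m d τ stuck)
    closed-step closed inv τ∈S range τy | d , d∈ , refl | inj₂ known with witness known
    ... | ed , ed∈es , refl , refl , σ∈S = target ed , σ∈S , proj₂ (All.lookup (neighbours inv) ed∈es) _ τy

    closed-component : ∀ {es S τ x} → Closed (offsets task) es S → Invariant S es → τ ∈ S →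
                       InRes G p q (emb τ) x → x ∈ map emb S
    closed-component closed inv τ∈S ε = ∈-map⁺ emb τ∈S
    closed-component closed inv τ∈S ((s , range , τy) ◅ path) with closed-step closed inv τ∈S range τy
    ... | σ , σ∈S , refl = closed-component closed inv σ∈S path

    component-↭ : ∀ {es S} → Closed (offsets task) es S → Unique S → Invariant S es → Lr ↭ map emb S
    component-↭ {es} {S} closed unique inv =
      ∼bag⇒↭ (unique∧set⇒bag (proj₁ enumeration) (Unique.map⁺ emb-injective unique) (mk⇔ into onto))
      where
      into : ∀ {x} → x ∈ Lr → x ∈ map emb S
      into {x} x∈Lr = closed-component closed inv (has-root inv) (Equivalence.to (proj₂ enumeration x) x∈Lr)
      onto : ∀ {x} → x ∈ map emb S → x ∈ Lr
      onto {x} x∈S with ∈-map⁻ emb x∈S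
      ... | τ , τ∈S , refl = Equivalence.from (proj₂ enumeration x) (All.lookup (reached inv) τ∈S)

    leaf-descents : ∀ {es S} → T (⌊ closed? (offsets task) es S ⌋ ∧ ⌊ unique? _≟ʷ_ S ⌋
                                  ∧ isPermutation (≡-dec _≟_) (map (descentsOf task) S) D) →
                    Invariant S es → map (resDes p q) Lr ↭ D
    leaf-descents {es} {S} ok inv =
      let closed , rest = ∧-split {⌊ closed? (offsets task) es S ⌋} ok
          unique , perm = ∧-split {⌊ unique? _≟ʷ_ S ⌋} rest
      in ↭-trans (↭.map⁺ (resDes p q) (component-↭ (toWitness closed) (toWitness unique) inv))
           (↭-trans (↭-reflexive (trans (sym (map-∘ S)) (map-cong-local (All.map (resDes-emb e e≤1) (sized inv)))))
             (isPermutation-sound (≡-dec _≟_) _ D perm))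

    no-conflict : ∀ {S es d τ σ} → Invariant S es → Neighbour G (colour d) (emb τ) (emb σ) → ¬ Conflict es d τ σ
    no-conflict inv nb conflict with witness conflict
    ... | ed , ed∈es , refl , refl , ρ≢τ =
      ρ≢τ (emb-injective (neighbour-functional G nb (All.lookup (neighbours inv) ed∈es)))

    mutual
      explore-sound : ∀ k S es → T (explore k task S es) → Invariant S es → map (resDes p q) Lr ↭ D
      explore-sound (suc k) S es ok inv with find (unexplored? es) (cartesianProduct (offsets task) S) in found
      ... | nothing      = leaf-descents ok inv
      ... | just (d , τ) with find-just (unexplored? es) (cartesianProduct (offsets task) S) found
      ...   | dτ∈ , mov , _ with ∈-cartesianProduct⁻ (offsets task) S dτ∈
      ...     | d∈ , τ∈S =
        let m , nb = emb-neighbour (All.lookup (sized inv) τ∈S) (offset-small d∈)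
                                   (reached-vertex root-vertex (All.lookup (reached inv) τ∈S)) mov
        in grow-sound k S es d τ m (pick (grow k task S es d τ) m ok) inv d∈ τ∈S nb

      grow-sound : ∀ k S es d τ m → T (grow k task S es d τ m) → Invariant S es → d ∈ offsets task → τ ∈ S →
                   Neighbour G (colour d) (emb τ) (emb (moveAt m d τ)) → map (resDes p q) Lr ↭ D
      grow-sound k S es d τ m ok inv d∈ τ∈S nb with conflict? es d τ (moveAt m d τ)
      ... | yes conflict = ⊥-elim (no-conflict inv nb conflict)
      ... | no _ =
        let σ = moveAt m d τ
            sized′ , rest = ∧-split {length σ ≡ᵇ 5} ok
            mov , ok′ = ∧-split {movable d σ} rest
            len = ≡ᵇ⇒≡ (length σ) 5 sized′
            σ-reached = All.lookup (reached inv) τ∈S ◅◅ ((colour d , offset-colour d∈ , proj₁ nb) ◅ ε)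
        in explore-sound k (insert σ S) (edge d τ σ ∷ edge d σ τ ∷ es) ok′ record
             { neighbours = nb ∷ emb-neighbour-sym len (offset-small d∈) nb mov ∷ neighbours inv
             ; sized      = insert-All len (sized inv)
             ; has-root   = insert-∈ (has-root inv)
             ; reached    = insert-All σ-reached (reached inv) }

    one∈offsets : 1 ∈ offsets task
    one∈offsets = one∈ e≤1
      where
      one∈ : ∀ {e} → e ≤ 1 → 1 ∈ e ∷ suc e ∷ []
      one∈ z≤n       = there (here refl)
      one∈ (s≤s z≤n) = here refl

    descents-↭ : ∀ {σ} → T (exploreFrom task 1 root σ) → E G (colour 1) (emb root) (emb σ) →
                 map (resDes p q) Lr ↭ D
    descents-↭ {σ} ok rootσ =
      let lenτ , ok₁ = ∧-split {length root ≡ᵇ 5} ok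
          lenσ , ok₂ = ∧-split {length σ ≡ᵇ 5} ok₁
          movτ , ok₃ = ∧-split {movable 1 root} ok₂
          movσ , ok₄ = ∧-split {movable 1 σ} ok₃
          len-root = ≡ᵇ⇒≡ (length root) 5 lenτ
          len-σ = ≡ᵇ⇒≡ (length σ) 5 lenσ
          nb = neighbour-of-edge G rootσ (subst T (sym (movable-emb len-root (s≤s z≤n))) movτ)
      in explore-sound 5 (root ∷ σ ∷ []) (edge 1 root σ ∷ edge 1 σ root ∷ []) ok₄ record
           { neighbours = nb ∷ emb-neighbour-sym len-σ (s≤s z≤n) nb movσ ∷ []
           ; sized      = len-root ∷ len-σ ∷ []
           ; has-root   = here refl
           ; reached    = ε ∷ ((colour 1 , offset-colour one∈offsets , rootσ) ◅ ε) ∷ [] }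

  restrictions-agree : ∀ {π w v} → T (isMovable π) →
    w ≡ emb (standardWindow π) → v ≡ emb (moveAt rotation 1 (standardWindow π)) → V G w → E G (3 + L) w v →
    ∀ L₁ L₂ → Enumerates (InRes G (1 + L) (4 + L) w) L₁ → Enumerates (InRes G (2 + L) (4 + L + 1) w) L₂ →
    ∀ α → resGFcoeff (1 + L) (4 + L) L₁ α ≡ resGFcoeff (2 + L) (4 + L + 1) L₂ α
  restrictions-agree {π} mov refl refl Vw wv L₁ L₂ enum₁ enum₂ α =
    subst (λ q → resGFcoeff (1 + L) (4 + L) L₁ α ≡ resGFcoeff (2 + L) q L₂ α) (sym last≡)
      (resGFcoeff-↭ (1 + L) (4 + L) (2 + L) (5 + L)
        (↭-trans (restricted 0 z≤n L₁ enum₁) (↭-sym (restricted 1 (s≤s z≤n) L₂ enum₂′))) α)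
    where
    last≡ : 4 + L + 1 ≡ 5 + L
    last≡ = +-comm (4 + L) 1
    enum₂′ : Enumerates (InRes G (2 + L) (5 + L) (emb (standardWindow π))) L₂
    enum₂′ = subst (λ q → Enumerates (InRes G (2 + L) q (emb (standardWindow π))) L₂) last≡ enum₂
    restricted : ∀ e (e≤1 : e ≤ 1) Lr → Enumerates (InRes G (1 + e + L) (4 + e + L) (emb (standardWindow π))) Lr →
                 map (resDes (1 + e + L) (4 + e + L)) Lr ↭ descents π
    restricted e e≤1 Lr enum = Component.descents-↭ e e≤1 (descents π) (standardWindow π) Vw Lr enum
                                 (exploration-succeeds e π e≤1 mov) wv

record Configuration (post x y : Word) : Set where
  constructor configuration
  field
    π         : Pattern
    π-movable : T (isMovable π)
    embedding : OrderEmbedding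
    x≡        : x ≡ map (OrderEmbedding.ι embedding) (standardWindow π) ++ post
    y≡        : y ≡ map (OrderEmbedding.ι embedding) (moveAt rotation 1 (standardWindow π)) ++ post

rotation-configuration : ∀ l₁ p q r l₅ z m →
  l₁ ≢ p → l₁ ≢ q → l₁ ≢ r → p ≢ l₅ → q ≢ l₅ → r ≢ l₅ → 0 < p → 0 < q → 0 < r →
  asc (l₁ ∷ p ∷ q ∷ r ∷ l₅ ∷ z) 1 ≢ asc (l₁ ∷ apply m (p ∷ q ∷ r ∷ l₅ ∷ z)) 1 →
  asc (l₁ ∷ p ∷ q ∷ r ∷ l₅ ∷ z) 4 ≢ asc (l₁ ∷ apply m (p ∷ q ∷ r ∷ l₅ ∷ z)) 4 →
  Configuration z (l₁ ∷ p ∷ q ∷ r ∷ l₅ ∷ z) (l₁ ∷ apply m (p ∷ q ∷ r ∷ l₅ ∷ z))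
rotation-configuration l₁ p q r l₅ z m l₁≢p l₁≢q l₁≢r p≢l₅ q≢l₅ r≢l₅ 0<p 0<q 0<r a₁ a₄
  with pattern3 p q r | pattern-view p q r | m
... | other | other       | knuth    = ⊥-elim (a₁ refl)
... | other | other       | rotation = ⊥-elim (a₁ refl)
... | bac   | bac _ _     | knuth    = ⊥-elim (a₁ refl)
... | bca   | bca _ _     | knuth    = ⊥-elim (a₁ refl)
... | acb   | acb _ _     | knuth    = ⊥-elim (a₄ refl)
... | cab   | cab _ _     | knuth    = ⊥-elim (a₄ refl)
... | bac   | bac a<b b<c | rotation =
  let a≤l₁ , l₁<b = separated-below a<b (≢-sym a₁) ; b<l₅ , l₅≤c = separated-above b<c (≢-sym a₄) in
  configuration bac tt
    (chain 0<q (≤∧≢⇒< a≤l₁ (≢-sym l₁≢q)) l₁<b b<l₅ (≤∧≢⇒< l₅≤c (≢-sym r≢l₅))) refl refl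
... | bca   | bca a<b b<c | rotation =
  let b≤l₁ , l₁<c = separated-below b<c a₁ ; a<l₅ , l₅≤b = separated-above a<b a₄ in
  configuration bca tt
    (chain 0<r a<l₅ (≤∧≢⇒< l₅≤b (≢-sym p≢l₅)) (≤∧≢⇒< b≤l₁ (≢-sym l₁≢p)) l₁<c) refl refl
... | acb   | acb a<b b<c | rotation =
  let a≤l₁ , l₁<b = separated-below a<b a₁ ; b<l₅ , l₅≤c = separated-above b<c a₄ in
  configuration acb tt
    (chain 0<p (≤∧≢⇒< a≤l₁ (≢-sym l₁≢p)) l₁<b b<l₅ (≤∧≢⇒< l₅≤c (≢-sym q≢l₅))) refl refl
... | cab   | cab a<b b<c | rotation =
  let b≤l₁ , l₁<c = separated-below b<c (≢-sym a₁) ; a<l₅ , l₅≤b = separated-above a<b (≢-sym a₄) in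
  configuration cab tt
    (chain 0<q a<l₅ (≤∧≢⇒< l₅≤b (≢-sym r≢l₅)) (≤∧≢⇒< b≤l₁ (≢-sym l₁≢r)) l₁<c) refl refl

data WindowSplit : ℕ → Word → Set where
  split : ∀ pre l₁ p q r l₅ post → WindowSplit (length pre) (pre ++ l₁ ∷ p ∷ q ∷ r ∷ l₅ ∷ post)

window-split : ∀ k w → 5 + k ≤ length w → WindowSplit k w
window-split zero    (l₁ ∷ p ∷ q ∷ r ∷ l₅ ∷ post) _ = split [] l₁ p q r l₅ post
window-split (suc k) (a ∷ w) (s≤s fits) with window-split k w fits
... | split pre l₁ p q r l₅ post = split (a ∷ pre) l₁ p q r l₅ post
window-split zero    (_ ∷ [])             (s≤s ())
window-split zero    (_ ∷ _ ∷ [])         (s≤s (s≤s ()))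
window-split zero    (_ ∷ _ ∷ _ ∷ [])     (s≤s (s≤s (s≤s ())))
window-split zero    (_ ∷ _ ∷ _ ∷ _ ∷ []) (s≤s (s≤s (s≤s (s≤s ()))))

unique-++⁻ʳ : ∀ pre {z : Word} → Unique (pre ++ z) → Unique z
unique-++⁻ʳ []        u       = u
unique-++⁻ʳ (_ ∷ pre) (_ ∷ u) = unique-++⁻ʳ pre u

asc-≢-++ˡ : ∀ pre {x y} j → asc (pre ++ x) (suc j + length pre) ≢ asc (pre ++ y) (suc j + length pre) →
            asc x (suc j) ≢ asc y (suc j)
asc-≢-++ˡ pre {x} {y} j differ same = differ (trans (asc-++ˡ j pre x) (trans same (sym (asc-++ˡ j pre y))))

axiom4a-at-window : ∀ {N n} (G : D0Graph N n) pre l₁ p q r l₅ post {v} →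
  let w = pre ++ l₁ ∷ p ∷ q ∷ r ∷ l₅ ∷ post ; L = length pre in
  V G w → 5 + L ≤ n → E G (3 + L) w v →
  asc w (1 + L) ≢ asc v (1 + L) → asc w (4 + L) ≢ asc v (4 + L) →
  ∀ L₁ L₂ → Enumerates (InRes G (1 + L) (4 + L) w) L₁ → Enumerates (InRes G (2 + L) (4 + L + 1) w) L₂ →
  ∀ α → resGFcoeff (1 + L) (4 + L) L₁ α ≡ resGFcoeff (2 + L) (4 + L + 1) L₂ α
axiom4a-at-window G pre l₁ p q r l₅ post Vw fits wv a₁ a₄
  with unique-++⁻ʳ pre (proj₂ (proj₂ (V⊆W G _ Vw))) | All.++⁻ʳ pre (proj₁ (proj₂ (V⊆W G _ Vw)))
... | (l₁≢p ∷ l₁≢q ∷ l₁≢r ∷ _) ∷ (_ ∷ _ ∷ p≢l₅ ∷ _) ∷ (_ ∷ q≢l₅ ∷ _) ∷ (r≢l₅ ∷ _) ∷ _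
    | _ ∷ (0<p , _) ∷ (0<q , _) ∷ (0<r , _) ∷ _
  with edge-move (3 + length pre) (E-shape G _ _ _ wv)
... | m , v≡ with trans v≡ (moveAt-++ˡ m 1 pre (l₁ ∷ p ∷ q ∷ r ∷ l₅ ∷ post))
...   | refl with rotation-configuration l₁ p q r l₅ post m l₁≢p l₁≢q l₁≢r p≢l₅ q≢l₅ r≢l₅ 0<p 0<q 0<r
                    (asc-≢-++ˡ pre 0 a₁) (asc-≢-++ˡ pre 3 a₄)
...     | configuration π mov embedding x≡ y≡ =
  Window.restrictions-agree G pre post embedding fits mov (cong (pre ++_) x≡) (cong (pre ++_) y≡) Vw wv

proposition4p5 :
    ∀ (N n : ℕ) (G : D0Graph N n) (w v : Word) (i : ℕ) →
    V G w → 4 ≤ i → i + 1 ≤ n →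
    E G (i ∸ 1) w v → ¬ E G i w v →
    asc w (i ∸ 3) ≢ asc v (i ∸ 3) → asc w i ≢ asc v i →
    ∀ (L₁ L₂ : List Word) →
    Enumerates (InRes G (i ∸ 3) i w) L₁ →
    Enumerates (InRes G (i ∸ 2) (i + 1) w) L₂ →
    ∀ (α : ℕ → ℕ) → Monomial 4 α →
    resGFcoeff (i ∸ 3) i L₁ α ≡ resGFcoeff (i ∸ 2) (i + 1) L₂ α
proposition4p5 N n G w v (suc (suc (suc (suc k)))) Vw (s≤s (s≤s (s≤s (s≤s _)))) i+1≤n wv _ a₁ a₄
               L₁ L₂ enum₁ enum₂ α _
  with subst (_≤ n) (+-comm (4 + k) 1) i+1≤n
... | fits with window-split k w (subst (5 + k ≤_) (sym (proj₁ (V⊆W G w Vw))) fits)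
...   | split pre l₁ p q r l₅ post =
  axiom4a-at-window G pre l₁ p q r l₅ post Vw fits wv a₁ a₄ L₁ L₂ enum₁ enum₂ α
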